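{- Let $p < q$ be primes and $n = pq$. Then the line graph $L(\Gamma(\mathbb{Z}_n))$ is very cost effective.
   Context: $\mathbb{Z}_n$ is the ring of residue classes modulo $n$. The zero-divisor graph $\Gamma(\mathbb{Z}_n)$ has as vertices the nonzero zero-divisors of $\mathbb{Z}_n$, two distinct vertices $x,y$ being adjacent iff $xy = 0$. The line graph $L(G)$ of a simple graph $G$ has one vertex per edge of $G$, two such vertices being adjacent iff the corresponding edges share an endpoint. For a graph $G=(V,E)$, $N(v)$ denotes the open neighborhood of $v$. Given $S \subseteq V$, a vertex $v \in S$ is very cost effective if $|N(v)\cap S| < |N(v) \cap (V\setminus S)|$; a set $S$ is very cost effective if every vertex of $S$ is very cost effective. A bipartition $\{S, V\setminus S\}$ is very cost effective if both parts are very cost effective sets, and $G$ is very cost effective if it has a very cost effective bipartition. -}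

module Defs where

open import Data.Nat using (ℕ; _<_; _*_; _%_; _≡ᵇ_; _<ᵇ_)
open import Data.Nat.Properties using (≡-decSetoid)
open import Data.Nat.Divisibility using (_∣?_)
open import Relation.Nullary using (does)
open import Data.Bool using (Bool; true; false; _∧_; _∨_; not; T)
open import Data.List using (List; []; _∷_; length; filterᵇ; upTo; concatMap)
open import Data.List.Membership.Propositional using (_∈_)
open import Data.Product using (_×_; _,_; proj₁; proj₂; ∃)

-- A finite simple graph presented by an explicit duplicate-free list of
-- its vertices and a Boolean adjacency relation (symmetric, irreflexive
-- for the graphs constructed below).
record FinGraph : Set₁ where
  field
    Vtx   : Set
    verts : List Vtx
    adj   : Vtx → Vtx → Bool
open FinGraph public

degIn : (G : FinGraph) → (Vtx G → Bool) → Vtx G → ℕ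
degIn G S v = length (filterᵇ (λ w → adj G v w ∧ S w) (verts G))

VeryCostEffectiveVertex : (G : FinGraph) → (Vtx G → Bool) → Vtx G → Set
VeryCostEffectiveVertex G S v = degIn G S v < degIn G (λ w → not (S w)) v

VeryCostEffectiveSet : (G : FinGraph) → (Vtx G → Bool) → Set
VeryCostEffectiveSet G S =
  ∀ v → v ∈ verts G → T (S v) → VeryCostEffectiveVertex G S v

VeryCostEffectiveBipartition : (G : FinGraph) → (Vtx G → Bool) → Set
VeryCostEffectiveBipartition G S =
  VeryCostEffectiveSet G S × VeryCostEffectiveSet G (λ w → not (S w))

VeryCostEffective : FinGraph → Set
VeryCostEffective G = ∃ λ (S : Vtx G → Bool) → VeryCostEffectiveBipartition G S

-- Edges of Γ(ℤ_n): unordered pairs {x, y} of distinct residues, represented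
-- canonically as (x , y) with 0 < x < y < n and n ∣ x*y.
-- (Both endpoints are then automatically nonzero zero-divisors.)
zdEdges : ℕ → List (ℕ × ℕ)
zdEdges n = concatMap (λ x → filterᵇ (λ e → (0 <ᵇ proj₁ e) ∧ (proj₁ e <ᵇ proj₂ e)
                                           ∧ does (n ∣? (proj₁ e * proj₂ e)))
                                     (Data.List.map (λ y → (x , y)) (upTo n)))
                      (upTo n)

_==_ : ℕ × ℕ → ℕ × ℕ → Bool
(a , b) == (c , d) = (a ≡ᵇ c) ∧ (b ≡ᵇ d)

shareEndpoint : ℕ × ℕ → ℕ × ℕ → Bool
shareEndpoint (a , b) (c , d) = (a ≡ᵇ c) ∨ (a ≡ᵇ d) ∨ (b ≡ᵇ c) ∨ (b ≡ᵇ d)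

lineAdj : ℕ × ℕ → ℕ × ℕ → Bool
lineAdj e f = not (e == f) ∧ shareEndpoint e f

LΓ : ℕ → FinGraph
LΓ n = record { Vtx = ℕ × ℕ ; verts = zdEdges n ; adj = lineAdj }

module Submission where

-- The nonzero zero-divisors of ℤ_n are the
-- a·p (1 ≤ a < q) and the b·q (1 ≤ b < p), and a product of two of them is 0
-- exactly when one is of each kind.  So Γ(ℤ_n) is complete bipartite and its
-- line graph is the rook's graph on the board {1,…,q-1} × {1,…,p-1}, the edge
-- {a·p , b·q} sitting on the square (a , b).  Colour the board like a
-- chessboard.  Slide each neighbour of a square (a₀ , b₀) that has the colour
-- of (a₀ , b₀) along their common line, to the square paired with it by the
-- involution σ = (1 2)(3 4)(5 6)…, which permutes {1,…,m-1} for odd m (q is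
-- odd, and p is odd unless p = 2, when no two squares share a row).  This
-- injects the neighbours of the own colour into those of the other colour and
-- misses (σ a₀ , b₀), so both colour classes are very cost effective.

open import Defs
open import Data.Nat using (ℕ; _<_; _*_)
open import Data.Nat.Primality using (Prime)

open import Data.Nat
  using (zero; suc; pred; _+_; _≤_; z≤n; s≤s; _≡ᵇ_; _<ᵇ_; NonZero; >-nonZero; nonTrivial⇒n>1)
open import Data.Nat.Properties
open import Data.Bool using (Bool; true; false; T; not; _∧_; _∨_; _xor_; if_then_else_)
open import Data.Bool.Properties
  using (T-∧; T-∨; T-≡; not-involutive; not-¬; not-distribˡ-xor; not-distribʳ-xor;
         xor-identityʳ; xor-same; xor-assoc; xor-comm)
open import Data.Empty using (⊥; ⊥-elim)
open import Data.List using (List; []; _∷_; _++_; length; map; filterᵇ; upTo; concatMap)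
open import Data.List.Properties using (length-map; length-++)
open import Data.List.Membership.Propositional using (_∈_; lose; find)
open import Data.List.Membership.Propositional.Properties
  using (∈-∃++; ∈-++⁻; ∈-++⁺ˡ; ∈-++⁺ʳ; ∈-map⁺; ∈-map⁻; ∈-filter⁺; ∈-filter⁻;
         ∈-concatMap⁺; ∈-concatMap⁻; ∈-upTo⁺; ∈-upTo⁻)
open import Data.List.Relation.Unary.Any using (here; there)
import Data.List.Relation.Unary.All as All
import Data.List.Relation.Unary.All.Properties as AllProps
open import Data.List.Relation.Unary.AllPairs using ([]; _∷_)
open import Data.List.Relation.Unary.Unique.Propositional using (Unique)
import Data.List.Relation.Unary.Unique.Propositional.Properties as Unique
open import Data.Product using (_×_; _,_; proj₁; proj₂; ∃)
open import Data.Nat.Divisibility using (_∣_; divides; _∣?_; ∣⇒≤; n∣m*n; m∣m*n; ∣-trans; *-pres-∣)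
open import Data.Nat.Primality using (prime⇒irreducible; prime⇒nonZero; prime⇒nonTrivial; euclidsLemma)
open import Data.Nat.DivMod using (_/_; m*n/n≡m)
open import Data.Sum using (_⊎_; inj₁; inj₂; [_,_]′; swap)
open import Function using (id)
open import Function.Bundles using (_⇔_; mk⇔; Equivalence)
open import Relation.Nullary using (¬_; Dec; yes; no; does)
open import Relation.Nullary.Decidable using (T?)
open import Relation.Binary.PropositionalEquality
open import Relation.Binary.Definitions using (Tri; tri<; tri≈; tri>)

xor-cancelʳ : ∀ x y z → x xor z ≡ y xor z → x ≡ y
xor-cancelʳ x y z eq = begin
  x                 ≡⟨ xor-identityʳ x ⟨
  x xor false       ≡⟨ cong (x xor_) (xor-same z) ⟨
  x xor (z xor z)   ≡⟨ xor-assoc x z z ⟨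
  (x xor z) xor z   ≡⟨ cong (_xor z) eq ⟩
  (y xor z) xor z   ≡⟨ xor-assoc y z z ⟩
  y xor (z xor z)   ≡⟨ cong (y xor_) (xor-same z) ⟩
  y xor false       ≡⟨ xor-identityʳ y ⟩
  y                 ∎
  where open ≡-Reasoning

xor-cancelˡ : ∀ x {y z} → x xor y ≡ x xor z → y ≡ z
xor-cancelˡ x {y} {z} eq = xor-cancelʳ y z x (trans (xor-comm y x) (trans eq (xor-comm x z)))

T-does⇔ : {P : Set} (d : Dec P) → T (does d) ⇔ P
T-does⇔ (yes p) = mk⇔ (λ _ → p) (λ _ → _)
T-does⇔ (no ¬p) = mk⇔ (λ ()) ¬p

∨-here : ∀ x {y} → T x → T (x ∨ y)
∨-here x t = Equivalence.from (T-∨ {x}) (inj₁ t)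

∨-there : ∀ x {y} → T y → T (x ∨ y)
∨-there x t = Equivalence.from (T-∨ {x}) (inj₂ t)

T-not⇔¬T : ∀ {x} → T (not x) ⇔ (¬ T x)
T-not⇔¬T {true}  = mk⇔ (λ ()) (λ ¬t → ¬t _)
T-not⇔¬T {false} = mk⇔ (λ _ ()) (λ _ → _)

same-class : ∀ c {x y} → T (c xor x) → T (c xor y) → x ≡ y
same-class c cx cy = xor-cancelˡ c (trans (Equivalence.to T-≡ cx) (sym (Equivalence.to T-≡ cy)))

other-class : ∀ c {x y} → T (c xor y) → x ≡ not y → T (not (c xor x))
other-class c {x} {y} cy x≡¬y = Equivalence.from T-≡ (begin
  not (c xor x)       ≡⟨ not-distribʳ-xor c x ⟩
  c xor not x         ≡⟨ cong (λ z → c xor not z) x≡¬y ⟩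
  c xor not (not y)   ≡⟨ cong (c xor_) (not-involutive y) ⟩
  c xor y             ≡⟨ Equivalence.to T-≡ cy ⟩
  true                ∎)
  where open ≡-Reasoning

unique-⊆⇒length-≤ : {A : Set} {xs ys : List A} →
                    Unique xs → (∀ {z} → z ∈ xs → z ∈ ys) → length xs ≤ length ys
unique-⊆⇒length-≤ {xs = []} _ _ = z≤n
unique-⊆⇒length-≤ {xs = x ∷ xs} (x∉xs ∷ xs-unique) xs⊆ys
  with ys₁ , ys₂ , refl ← ∈-∃++ (xs⊆ys (here refl)) = begin
    suc (length xs)                 ≤⟨ s≤s (unique-⊆⇒length-≤ xs-unique xs⊆ys₁++ys₂) ⟩
    suc (length (ys₁ ++ ys₂))       ≡⟨ cong suc (length-++ ys₁) ⟩
    suc (length ys₁ + length ys₂)   ≡⟨ +-suc (length ys₁) (length ys₂) ⟨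
    length ys₁ + length (x ∷ ys₂)   ≡⟨ length-++ ys₁ ⟨
    length (ys₁ ++ x ∷ ys₂)         ∎
  where
  open ≤-Reasoning
  -- removing the one occurrence of x from ys still leaves room for xs
  xs⊆ys₁++ys₂ : ∀ {z} → z ∈ xs → z ∈ ys₁ ++ ys₂
  xs⊆ys₁++ys₂ z∈xs with ∈-++⁻ ys₁ (xs⊆ys (there z∈xs))
  ... | inj₁ z∈ys₁         = ∈-++⁺ˡ z∈ys₁
  ... | inj₂ (here refl)   = ⊥-elim (All.lookup x∉xs z∈xs refl)
  ... | inj₂ (there z∈ys₂) = ∈-++⁺ʳ ys₁ z∈ys₂

map-unique : {A B : Set} (f : A → B) {xs : List A} → Unique xs →
             (∀ {x y} → x ∈ xs → y ∈ xs → f x ≡ f y → x ≡ y) → Unique (map f xs)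
map-unique f {[]}     []                 _   = []
map-unique f {x ∷ xs} (x∉xs ∷ xs-unique) inj =
  AllProps.map⁺ (All.tabulate λ y∈xs fx≡fy → All.lookup x∉xs y∈xs (inj (here refl) (there y∈xs) fx≡fy))
  ∷ map-unique f xs-unique (λ x∈ y∈ → inj (there x∈) (there y∈))

fewer-by-injection :
  {A : Set} (L : List A) → Unique L → (P Q : A → Bool) (f : A → A) (b : A) →
  (∀ {w} → w ∈ L → T (P w) → f w ∈ L × T (Q (f w))) →
  (∀ {w w′} → w ∈ L → w′ ∈ L → T (P w) → T (P w′) → f w ≡ f w′ → w ≡ w′) →
  b ∈ L → T (Q b) → (∀ {w} → w ∈ L → T (P w) → f w ≢ b) →
  length (filterᵇ P L) < length (filterᵇ Q L)
fewer-by-injection L L-unique P Q f b f-into f-inj b∈L Qb f-avoids-b =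
  subst (λ k → suc k ≤ length (filterᵇ Q L)) (length-map f (filterᵇ P L))
        (unique-⊆⇒length-≤ image-unique image⊆Q)
  where
  Ps = filterᵇ P L
  P-member : ∀ {w} → w ∈ Ps → w ∈ L × T (P w)
  P-member = ∈-filter⁻ (λ x → T? (P x))
  image-unique : Unique (b ∷ map f Ps)
  image-unique = All.tabulate b∉image ∷ map-unique f (Unique.filter⁺ (λ x → T? (P x)) L-unique) inj
    where
    inj : ∀ {x y} → x ∈ Ps → y ∈ Ps → f x ≡ f y → x ≡ y
    inj x∈ y∈ = let x∈L , Px = P-member x∈; y∈L , Py = P-member y∈ in f-inj x∈L y∈L Px Py
    b∉image : ∀ {z} → z ∈ map f Ps → b ≢ z
    b∉image z∈ b≡z with w , w∈ , refl ← ∈-map⁻ f z∈ =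
      let w∈L , Pw = P-member w∈ in f-avoids-b w∈L Pw (sym b≡z)
  image⊆Q : ∀ {z} → z ∈ b ∷ map f Ps → z ∈ filterᵇ Q L
  image⊆Q (here refl) = ∈-filter⁺ (λ x → T? (Q x)) b∈L Qb
  image⊆Q (there z∈) with w , w∈ , refl ← ∈-map⁻ f z∈ =
    let w∈L , Pw = P-member w∈; fw∈L , Qfw = f-into w∈L Pw in ∈-filter⁺ (λ x → T? (Q x)) fw∈L Qfw

odd : ℕ → Bool
odd zero    = false
odd (suc n) = not (odd n)

σ : ℕ → ℕ
σ a = if odd a then suc a else pred a

σ-involutive : ∀ a → σ (σ a) ≡ a
σ-involutive zero = refl
σ-involutive (suc a) with odd a in eq
... | true  rewrite eq = refl
... | false rewrite eq = refl

σ-injective : ∀ {a a′} → σ a ≡ σ a′ → a ≡ a′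
σ-injective {a} {a′} eq = trans (sym (σ-involutive a)) (trans (cong σ eq) (σ-involutive a′))

odd-σ : ∀ {a} → 1 ≤ a → odd (σ a) ≡ not (odd a)
odd-σ {suc a} _ with odd a in eq
... | true  rewrite eq = refl
... | false rewrite eq = refl

σ-flips : ∀ {a a′} → 1 ≤ a → odd a ≡ odd a′ → σ a ≢ a′
σ-flips {a} {a′} 1≤a same σa≡a′ = not-¬ refl (begin
  odd a′          ≡⟨ cong odd σa≡a′ ⟨
  odd (σ a)       ≡⟨ odd-σ 1≤a ⟩
  not (odd a)     ≡⟨ cong not same ⟩
  not (odd a′)    ∎)
  where open ≡-Reasoning

-- For odd m, σ permutes {1, …, m-1} (which splits into the pairs {2i-1, 2i}).
σ-bounded : ∀ {a m} → 1 ≤ a → a < m → odd m ≡ true → 1 ≤ σ a × σ a < m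
σ-bounded {suc a} {m} _ a<m m-odd with odd a in eq
... | false = s≤s z≤n , ≤∧≢⇒< a<m 2+a≢m
  where
  2+a≢m : suc (suc a) ≢ m
  2+a≢m 2+a≡m
    with () ← trans (sym eq) (trans (sym (not-involutive (odd a))) (trans (cong odd 2+a≡m) m-odd))
... | true = odd⇒1≤ eq , ≤-trans (n≤1+n (suc a)) a<m
  where
  odd⇒1≤ : ∀ {b} → odd b ≡ true → 1 ≤ b
  odd⇒1≤ {suc _} _ = s≤s z≤n

even⇒2∣ : ∀ m → odd m ≡ false → 2 ∣ m
even⇒2∣ zero          _ = divides 0 refl
even⇒2∣ (suc (suc m)) e with divides k refl ← even⇒2∣ m (trans (sym (not-involutive (odd m))) e)
  = divides (suc k) refl

prime⇒2⊎odd : ∀ {m} → Prime m → m ≡ 2 ⊎ odd m ≡ true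
prime⇒2⊎odd {m} m-prime with odd m in eq
... | true = inj₂ refl
... | false with prime⇒irreducible m-prime (even⇒2∣ m eq)
...   | inj₁ ()
...   | inj₂ 2≡m = inj₁ (sym 2≡m)

prime∤product : ∀ {r a s} → Prime r → 1 ≤ a → a < r → ¬ r ∣ s → ¬ r ∣ a * s
prime∤product {r} {a} {s} r-prime 1≤a a<r r∤s r∣as with euclidsLemma a s r-prime r∣as
... | inj₁ r∣a = <⇒≱ a<r (∣⇒≤ {{>-nonZero 1≤a}} r∣a)
... | inj₂ r∣s = r∤s r∣s

multiple-bounds : ∀ {z a m k} → z ≡ a * m → 0 < z → z < k * m → 1 ≤ a × a < k
multiple-bounds {a = zero}              refl ()
multiple-bounds {a = suc a} {m} {k}     refl _  z<km = s≤s z≤n , *-cancelʳ-< m (suc a) k z<km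

module RookGraph (m k : ℕ) where

  Cell : ℕ × ℕ → Set
  Cell (a , b) = (1 ≤ a × a < m) × (1 ≤ b × b < k)

  RookAdj : ℕ × ℕ → ℕ × ℕ → Set
  RookAdj (a₀ , b₀) (a , b) = (a ≢ a₀ × b ≡ b₀) ⊎ (a ≡ a₀ × b ≢ b₀)

  rookAdj⇔ : ∀ {a₀ b₀ a b} →
             RookAdj (a₀ , b₀) (a , b) ⇔ ((a₀ , b₀) ≢ (a , b) × (a₀ ≡ a ⊎ b₀ ≡ b))
  rookAdj⇔ = mk⇔ to from
    where
    to : ∀ {a₀ b₀ a b} → RookAdj (a₀ , b₀) (a , b) →
         (a₀ , b₀) ≢ (a , b) × (a₀ ≡ a ⊎ b₀ ≡ b)
    to (inj₁ (a≢a₀ , refl)) = (λ eq → a≢a₀ (sym (cong proj₁ eq))) , inj₂ refl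
    to (inj₂ (refl , b≢b₀)) = (λ eq → b≢b₀ (sym (cong proj₂ eq))) , inj₁ refl
    from : ∀ {a₀ b₀ a b} → (a₀ , b₀) ≢ (a , b) × (a₀ ≡ a ⊎ b₀ ≡ b) →
           RookAdj (a₀ , b₀) (a , b)
    from (c₀≢c , inj₁ refl) = inj₂ (refl , λ { refl → c₀≢c refl })
    from (c₀≢c , inj₂ refl) = inj₁ ((λ { refl → c₀≢c refl }) , refl)

  colour : ℕ × ℕ → Bool
  colour (a , b) = odd a xor odd b

  slide : ℕ × ℕ → ℕ × ℕ → ℕ × ℕ
  slide (a₀ , b₀) (a , b) = if b ≡ᵇ b₀ then (σ a , b) else (a , σ b)

  module Neighbours (m-odd : odd m ≡ true) (k≡2⊎odd : k ≡ 2 ⊎ odd k ≡ true)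
                    {a₀ b₀ : ℕ} (cell₀ : Cell (a₀ , b₀)) where

    SameNbr : ℕ × ℕ → Set
    SameNbr c = Cell c × RookAdj (a₀ , b₀) c × colour c ≡ colour (a₀ , b₀)

    OtherNbr : ℕ × ℕ → Set
    OtherNbr c = Cell c × RookAdj (a₀ , b₀) c × colour c ≡ not (colour (a₀ , b₀))

    slide-column : ∀ {a b} → b ≡ b₀ → slide (a₀ , b₀) (a , b) ≡ (σ a , b)
    slide-column {b = b} b≡b₀ with b ≡ᵇ b₀ in eq
    ... | true  = refl
    ... | false with () ← subst T eq (≡⇒≡ᵇ b b₀ b≡b₀)

    slide-row : ∀ {a b} → b ≢ b₀ → slide (a₀ , b₀) (a , b) ≡ (a , σ b)
    slide-row {b = b} b≢b₀ with b ≡ᵇ b₀ in eq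
    ... | true  = ⊥-elim (b≢b₀ (≡ᵇ⇒≡ b b₀ (subst T (sym eq) _)))
    ... | false = refl

    k-odd : ∀ {b} → Cell (a₀ , b) → b ≢ b₀ → odd k ≡ true
    k-odd {b} (_ , 1≤b , b<k) b≢b₀ = [ (λ k≡2 → ⊥-elim (b≢b₀ (both-1 k≡2))) , id ]′ k≡2⊎odd
      where
      -- on a board with k = 2 every row has the single square 1
      is-1 : ∀ {x} → 1 ≤ x → x < 2 → x ≡ 1
      is-1 1≤x x<2 = ≤-antisym (≤-pred x<2) 1≤x
      both-1 : k ≡ 2 → b ≡ b₀
      both-1 k≡2 = trans (is-1 1≤b (subst (b <_) k≡2 b<k))
                         (sym (is-1 (proj₁ (proj₂ cell₀)) (subst (b₀ <_) k≡2 (proj₂ (proj₂ cell₀)))))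

    colour-σ₁ : ∀ {a b} → 1 ≤ a → colour (σ a , b) ≡ not (colour (a , b))
    colour-σ₁ {a} {b} 1≤a = trans (cong (_xor odd b) (odd-σ 1≤a)) (sym (not-distribˡ-xor (odd a) (odd b)))

    colour-σ₂ : ∀ {a b} → 1 ≤ b → colour (a , σ b) ≡ not (colour (a , b))
    colour-σ₂ {a} {b} 1≤b = trans (cong (odd a xor_) (odd-σ 1≤b)) (sym (not-distribʳ-xor (odd a) (odd b)))

    slide-other : ∀ {c} → SameNbr c → OtherNbr (slide (a₀ , b₀) c)
    slide-other {a , b} (cell@((1≤a , a<m) , _) , inj₁ (_ , refl) , same)
      rewrite slide-column {a} refl =
        (σ-bounded {a} 1≤a a<m m-odd , proj₂ cell)
      , inj₁ (σ-flips 1≤a (xor-cancelʳ _ _ (odd b₀) same) , refl)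
      , trans (colour-σ₁ {a} {b₀} 1≤a) (cong not same)
    slide-other {a , b} (cell@(_ , 1≤b , b<k) , inj₂ (refl , b≢b₀) , same)
      rewrite slide-row {a₀} b≢b₀ =
        (proj₁ cell , σ-bounded 1≤b b<k (k-odd cell b≢b₀))
      , inj₂ (refl , σ-flips 1≤b (xor-cancelˡ (odd a₀) same))
      , trans (colour-σ₂ {a₀} {b} 1≤b) (cong not same)

    -- Sliding is injective: within the column or the row this is injectivity
    -- of σ; a column square cannot slide onto a row square, since its image
    -- in the column of c₀ would have the parity of a₀ flipped.
    slide-injective : ∀ {c c′} → SameNbr c → SameNbr c′ →
                      slide (a₀ , b₀) c ≡ slide (a₀ , b₀) c′ → c ≡ c′
    slide-injective {a , _} {a′ , _} (_ , inj₁ (_ , refl) , _) (_ , inj₁ (_ , refl) , _) eq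
      rewrite slide-column {a} refl | slide-column {a′} refl =
        cong (_, b₀) (σ-injective (cong proj₁ eq))
    slide-injective (_ , inj₂ (refl , b≢b₀) , _) (_ , inj₂ (refl , b′≢b₀) , _) eq
      rewrite slide-row {a₀} b≢b₀ | slide-row {a₀} b′≢b₀ =
        cong (a₀ ,_) (σ-injective (cong proj₂ eq))
    slide-injective {a , _} (((1≤a , _) , _) , inj₁ (_ , refl) , same) (_ , inj₂ (refl , b′≢b₀) , _) eq
      rewrite slide-column {a} refl | slide-row {a₀} b′≢b₀ =
        ⊥-elim (σ-flips 1≤a (xor-cancelʳ _ _ (odd b₀) same) (cong proj₁ eq))
    slide-injective {_} {a′ , _}
      (_ , inj₂ (refl , b≢b₀) , _) (((1≤a′ , _) , _) , inj₁ (_ , refl) , same′) eq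
      rewrite slide-row {a₀} b≢b₀ | slide-column {a′} refl =
        ⊥-elim (σ-flips 1≤a′ (xor-cancelʳ _ _ (odd b₀) same′) (sym (cong proj₁ eq)))

    partner-other : OtherNbr (σ a₀ , b₀)
    partner-other = (σ-bounded 1≤a₀ (proj₂ (proj₁ cell₀)) m-odd , proj₂ cell₀)
                  , inj₁ (σ-flips 1≤a₀ refl , refl)
                  , colour-σ₁ {a₀} {b₀} 1≤a₀
      where 1≤a₀ = proj₁ (proj₁ cell₀)

    slide-avoids-partner : ∀ {c} → SameNbr c → slide (a₀ , b₀) c ≢ (σ a₀ , b₀)
    slide-avoids-partner {a , b} (_ , inj₁ (a≢a₀ , refl) , _) eq
      rewrite slide-column {a} refl = a≢a₀ (σ-injective (cong proj₁ eq))
    slide-avoids-partner {a , b} (_ , inj₂ (refl , b≢b₀) , _) eq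
      rewrite slide-row {a₀} b≢b₀ = σ-flips (proj₁ (proj₁ cell₀)) refl (sym (cong proj₁ eq))

  record Presentation (G : FinGraph) : Set where
    field
      verts-unique  : Unique (verts G)
      encode        : ℕ × ℕ → Vtx G
      decode        : Vtx G → ℕ × ℕ
      encode-∈      : ∀ {c} → Cell c → encode c ∈ verts G
      decode-cell   : ∀ {v} → v ∈ verts G → Cell (decode v)
      encode-decode : ∀ {v} → v ∈ verts G → encode (decode v) ≡ v
      decode-encode : ∀ {c} → Cell c → decode (encode c) ≡ c
      adj⇔rookAdj   : ∀ {c₀ c} → Cell c₀ → Cell c → T (adj G (encode c₀) (encode c)) ⇔ RookAdj c₀ c

    encode-injective : ∀ {c c′} → Cell c → Cell c′ → encode c ≡ encode c′ → c ≡ c′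
    encode-injective cell cell′ eq =
      trans (sym (decode-encode cell)) (trans (cong decode eq) (decode-encode cell′))

  module _ (m-odd : odd m ≡ true) (k≡2⊎odd : k ≡ 2 ⊎ odd k ≡ true)
           {G : FinGraph} (pres : Presentation G) where
    open Presentation pres

    chequer : Vtx G → Bool
    chequer v = colour (decode v)

    fewer-same-coloured :
      ∀ {v} → v ∈ verts G → (Same Other : Vtx G → Bool) →
      (∀ {w} → T (Same w) → T (adj G v w) × chequer w ≡ chequer v) →
      (∀ {w} → T (adj G v w) → chequer w ≡ not (chequer v) → T (Other w)) →
      length (filterᵇ Same (verts G)) < length (filterᵇ Other (verts G))
    fewer-same-coloured {v} v∈ Same Other same-sound other-complete =
      fewer-by-injection (verts G) verts-unique Same Other f (encode partner)
        (λ w∈ Sw → other-nbr (slide-other (same-nbr w∈ Sw)))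
        f-injective
        (proj₁ (other-nbr partner-other)) (proj₂ (other-nbr partner-other))
        f-avoids-partner
      where
      open Neighbours m-odd k≡2⊎odd (decode-cell v∈)
      c₀ = decode v
      partner = (σ (proj₁ c₀) , proj₂ c₀)

      f : Vtx G → Vtx G
      f w = encode (slide c₀ (decode w))

      adj-to-v : ∀ {c} → Cell c → T (adj G v (encode c)) ⇔ RookAdj c₀ c
      adj-to-v {c} cell = subst (λ u → T (adj G u (encode c)) ⇔ RookAdj c₀ c)
                                (encode-decode v∈) (adj⇔rookAdj (decode-cell v∈) cell)

      same-nbr : ∀ {w} → w ∈ verts G → T (Same w) → SameNbr (decode w)
      same-nbr {w} w∈ Sw =
        let v~w , same = same-sound Sw
            cell = decode-cell w∈
        in cell , Equivalence.to (adj-to-v cell) (subst (λ u → T (adj G v u)) (sym (encode-decode w∈)) v~w) , same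

      other-nbr : ∀ {c} → OtherNbr c → encode c ∈ verts G × T (Other (encode c))
      other-nbr (cell , rook , other) =
        encode-∈ cell , other-complete (Equivalence.from (adj-to-v cell) rook)
                                       (trans (cong colour (decode-encode cell)) other)

      f-injective : ∀ {w w′} → w ∈ verts G → w′ ∈ verts G → T (Same w) → T (Same w′) →
                    f w ≡ f w′ → w ≡ w′
      f-injective {w} {w′} w∈ w′∈ Sw Sw′ eq = begin
        w                   ≡⟨ encode-decode w∈ ⟨
        encode (decode w)   ≡⟨ cong encode (slide-injective nbr nbr′ slides-equal) ⟩
        encode (decode w′)  ≡⟨ encode-decode w′∈ ⟩
        w′                  ∎
        where
        open ≡-Reasoning
        nbr = same-nbr w∈ Sw
        nbr′ = same-nbr w′∈ Sw′
        slides-equal = encode-injective (proj₁ (slide-other nbr)) (proj₁ (slide-other nbr′)) eq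

      f-avoids-partner : ∀ {w} → w ∈ verts G → T (Same w) → f w ≢ encode partner
      f-avoids-partner w∈ Sw eq =
        let nbr = same-nbr w∈ Sw
        in slide-avoids-partner nbr (encode-injective (proj₁ (slide-other nbr)) (proj₁ partner-other) eq)

    colour-class-vce : ∀ c → VeryCostEffectiveSet G (λ w → c xor chequer w)
    colour-class-vce c v v∈ cv = fewer-same-coloured v∈ _ _ same-sound other-complete
      where
      same-sound : ∀ {w} → T (adj G v w ∧ (c xor chequer w)) → T (adj G v w) × chequer w ≡ chequer v
      same-sound t = let v~w , cw = Equivalence.to T-∧ t in v~w , same-class c cw cv
      other-complete : ∀ {w} → T (adj G v w) → chequer w ≡ not (chequer v) →
                       T (adj G v w ∧ not (c xor chequer w))
      other-complete v~w other = Equivalence.from T-∧ (v~w , other-class c cv other)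

    rook-vce : VeryCostEffective G
    rook-vce = chequer , colour-class-vce false , colour-class-vce true

zdCondition : ℕ → ℕ × ℕ → Bool
zdCondition n e = (0 <ᵇ proj₁ e) ∧ (proj₁ e <ᵇ proj₂ e) ∧ does (n ∣? (proj₁ e * proj₂ e))

zdRow : ℕ → ℕ → List (ℕ × ℕ)
zdRow n x = filterᵇ (zdCondition n) (map (x ,_) (upTo n))

zdCondition⇔ : ∀ n {x y} → T (zdCondition n (x , y)) ⇔ (0 < x × x < y × n ∣ x * y)
zdCondition⇔ n {x} {y} = mk⇔ to from
  where
  to : T (zdCondition n (x , y)) → 0 < x × x < y × n ∣ x * y
  to t = let t₁ , t₂₃ = Equivalence.to T-∧ t
             t₂ , t₃ = Equivalence.to T-∧ t₂₃
         in <ᵇ⇒< 0 x t₁ , <ᵇ⇒< x y t₂ , Equivalence.to (T-does⇔ (n ∣? (x * y))) t₃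
  from : 0 < x × x < y × n ∣ x * y → T (zdCondition n (x , y))
  from (0<x , x<y , n∣xy) = Equivalence.from T-∧ (<⇒<ᵇ 0<x ,
    Equivalence.from T-∧ (<⇒<ᵇ x<y , Equivalence.from (T-does⇔ (n ∣? (x * y))) n∣xy))

∈-zdEdges⁺ : ∀ n {x y} → 0 < x → x < y → y < n → n ∣ x * y → (x , y) ∈ zdEdges n
∈-zdEdges⁺ n {x} {y} 0<x x<y y<n n∣xy =
  ∈-concatMap⁺ (zdRow n) (lose (∈-upTo⁺ (<-trans x<y y<n))
    (∈-filter⁺ (λ e → T? (zdCondition n e)) (∈-map⁺ (x ,_) (∈-upTo⁺ y<n))
      (Equivalence.from (zdCondition⇔ n) (0<x , x<y , n∣xy))))

∈-zdEdges⁻ : ∀ n {x y} → (x , y) ∈ zdEdges n → 0 < x × x < y × y < n × n ∣ x * y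
∈-zdEdges⁻ n {x} {y} e∈
  with x′ , _ , e∈row ← find (∈-concatMap⁻ (zdRow n) {xs = upTo n} e∈)
  with e∈pairs , cond ← ∈-filter⁻ (λ e → T? (zdCondition n e)) {xs = map (x′ ,_) (upTo n)} e∈row
  with y′ , y∈ , refl ← ∈-map⁻ (x′ ,_) e∈pairs
  = let 0<x , x<y , n∣xy = Equivalence.to (zdCondition⇔ n) cond in 0<x , x<y , ∈-upTo⁻ y∈ , n∣xy

-- zdEdges n has no repetitions: rows are duplicate free and have distinct
-- first coordinates.
zdEdges-unique : ∀ n → Unique (zdEdges n)
zdEdges-unique n = rows-unique (upTo n) (Unique.upTo⁺ n)
  where
  row-first : ∀ x {e} → e ∈ zdRow n x → proj₁ e ≡ x
  row-first x e∈
    with e∈pairs , _ ← ∈-filter⁻ (λ e → T? (zdCondition n e)) {xs = map (x ,_) (upTo n)} e∈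
    with y , _ , refl ← ∈-map⁻ (x ,_) e∈pairs
    = refl
  row-unique : ∀ x → Unique (zdRow n x)
  row-unique x = Unique.filter⁺ (λ e → T? (zdCondition n e)) (Unique.map⁺ (cong proj₂) (Unique.upTo⁺ n))
  rows-unique : ∀ xs → Unique xs → Unique (concatMap (zdRow n) xs)
  rows-unique []       _                  = []
  rows-unique (x ∷ xs) (x∉xs ∷ xs-unique) = Unique.++⁺ (row-unique x) (rows-unique xs xs-unique) disjoint
    where
    disjoint : ∀ {e} → ¬ (e ∈ zdRow n x × e ∈ concatMap (zdRow n) xs)
    disjoint (e∈x , e∈xs) with x′ , x′∈xs , e∈x′ ← find (∈-concatMap⁻ (zdRow n) {xs = xs} e∈xs) =
      All.lookup x∉xs x′∈xs (trans (sym (row-first x e∈x)) (row-first x′ e∈x′))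

==⇔≡ : ∀ {e f : ℕ × ℕ} → T (e == f) ⇔ e ≡ f
==⇔≡ {x , y} {x′ , y′} = mk⇔ to from
  where
  to : T ((x , y) == (x′ , y′)) → (x , y) ≡ (x′ , y′)
  to t = let t₁ , t₂ = Equivalence.to T-∧ t in cong₂ _,_ (≡ᵇ⇒≡ x x′ t₁) (≡ᵇ⇒≡ y y′ t₂)
  from : (x , y) ≡ (x′ , y′) → T ((x , y) == (x′ , y′))
  from refl = Equivalence.from T-∧ (≡⇒≡ᵇ x x refl , ≡⇒≡ᵇ y y refl)

Endpoint : ℕ → ℕ × ℕ → Set
Endpoint u (x , y) = u ≡ x ⊎ u ≡ y

shareEndpoint⇔ : ∀ {e f} → T (shareEndpoint e f) ⇔ ∃ λ u → Endpoint u e × Endpoint u f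
shareEndpoint⇔ {x , y} {z , w} = mk⇔ to from
  where
  to : T (shareEndpoint (x , y) (z , w)) → ∃ λ u → Endpoint u (x , y) × Endpoint u (z , w)
  to t with Equivalence.to (T-∨ {x ≡ᵇ z}) t
  ... | inj₁ x=z = x , inj₁ refl , inj₁ (≡ᵇ⇒≡ x z x=z)
  ... | inj₂ t′ with Equivalence.to (T-∨ {x ≡ᵇ w}) t′
  ...   | inj₁ x=w = x , inj₁ refl , inj₂ (≡ᵇ⇒≡ x w x=w)
  ...   | inj₂ t″ with Equivalence.to (T-∨ {y ≡ᵇ z}) t″
  ...     | inj₁ y=z = y , inj₂ refl , inj₁ (≡ᵇ⇒≡ y z y=z)
  ...     | inj₂ y=w = y , inj₂ refl , inj₂ (≡ᵇ⇒≡ y w y=w)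
  from : (∃ λ u → Endpoint u (x , y) × Endpoint u (z , w)) → T (shareEndpoint (x , y) (z , w))
  from (u , inj₁ refl , inj₁ refl) = ∨-here (x ≡ᵇ z) (≡⇒≡ᵇ u u refl)
  from (u , inj₁ refl , inj₂ refl) = ∨-there (x ≡ᵇ z) (∨-here (x ≡ᵇ w) (≡⇒≡ᵇ u u refl))
  from (u , inj₂ refl , inj₁ refl) = ∨-there (x ≡ᵇ z) (∨-there (x ≡ᵇ w) (∨-here (y ≡ᵇ z) (≡⇒≡ᵇ u u refl)))
  from (u , inj₂ refl , inj₂ refl) = ∨-there (x ≡ᵇ z) (∨-there (x ≡ᵇ w) (∨-there (y ≡ᵇ z) (≡⇒≡ᵇ u u refl)))


module ProductOfTwoPrimes {p q : ℕ} (p-prime : Prime p) (q-prime : Prime q) (p<q : p < q) where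
  open RookGraph q p

  instance
    p≢0 : NonZero p
    p≢0 = prime⇒nonZero p-prime
    q≢0 : NonZero q
    q≢0 = prime⇒nonZero q-prime

  1<p : 1 < p
  1<p = nonTrivial⇒n>1 p {{prime⇒nonTrivial p-prime}}

  q∤p : ¬ q ∣ p
  q∤p q∣p = <⇒≱ p<q (∣⇒≤ q∣p)

  p∤q : ¬ p ∣ q
  p∤q p∣q with prime⇒irreducible q-prime p∣q
  ... | inj₁ p≡1 = <⇒≢ 1<p (sym p≡1)
  ... | inj₂ p≡q = <⇒≢ p<q p≡q

  edge : ℕ × ℕ → ℕ × ℕ
  edge (a , b) = if a * p <ᵇ b * q then (a * p , b * q) else (b * q , a * p)

  coords : ℕ × ℕ → ℕ × ℕ
  coords (x , y) = if does (p ∣? x) then (x / p , y / q) else (y / p , x / q)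

  ap≢bq : ∀ {a b} → 1 ≤ a → a < q → a * p ≢ b * q
  ap≢bq {a} {b} 1≤a a<q ap≡bq = prime∤product q-prime 1≤a a<q q∤p (divides b ap≡bq)

  edge-< : ∀ a b → a * p < b * q → edge (a , b) ≡ (a * p , b * q)
  edge-< a b lt with a * p <ᵇ b * q in eq
  ... | true  = refl
  ... | false with () ← subst T eq (<⇒<ᵇ lt)

  edge-> : ∀ a b → b * q < a * p → edge (a , b) ≡ (b * q , a * p)
  edge-> a b gt with a * p <ᵇ b * q in eq
  ... | true  = ⊥-elim (<-asym gt (<ᵇ⇒< (a * p) (b * q) (subst T (sym eq) _)))
  ... | false = refl

  coords-edge : ∀ {c} → Cell c → coords (edge c) ≡ c
  coords-edge {a , b} (_ , 1≤b , b<p) with a * p <ᵇ b * q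
  ... | true with p ∣? (a * p)
  ...   | yes _   = cong₂ _,_ (m*n/n≡m a p) (m*n/n≡m b q)
  ...   | no p∤ap = ⊥-elim (p∤ap (n∣m*n a))
  coords-edge {a , b} (_ , 1≤b , b<p) | false with p ∣? (b * q)
  ...   | yes p∣bq = ⊥-elim (prime∤product p-prime 1≤b b<p p∤q p∣bq)
  ...   | no _     = cong₂ _,_ (m*n/n≡m a p) (m*n/n≡m b q)

  edge-injective : ∀ {c c′} → Cell c → Cell c′ → edge c ≡ edge c′ → c ≡ c′
  edge-injective cell cell′ eq = trans (sym (coords-edge cell)) (trans (cong coords eq) (coords-edge cell′))

  endpoint-edge : ∀ {u a b} → Endpoint u (edge (a , b)) ⇔ Endpoint u (a * p , b * q)
  endpoint-edge {u} {a} {b} with a * p <ᵇ b * q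
  ... | true  = mk⇔ id id
  ... | false = mk⇔ swap swap

  common-endpoint⇔ : ∀ {a b a′ b′} → Cell (a , b) → Cell (a′ , b′) →
    (∃ λ u → Endpoint u (edge (a , b)) × Endpoint u (edge (a′ , b′))) ⇔ (a ≡ a′ ⊎ b ≡ b′)
  common-endpoint⇔ {a} {b} {a′} {b′} ((1≤a , a<q) , _) ((1≤a′ , a′<q) , _) = mk⇔ to from
    where
    to : (∃ λ u → Endpoint u (edge (a , b)) × Endpoint u (edge (a′ , b′))) → a ≡ a′ ⊎ b ≡ b′
    to (u , e , e′) with Equivalence.to (endpoint-edge {u} {a} {b}) e
                       | Equivalence.to (endpoint-edge {u} {a′} {b′}) e′
    ... | inj₁ refl | inj₁ ap≡a′p = inj₁ (*-cancelʳ-≡ a a′ p ap≡a′p)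
    ... | inj₁ refl | inj₂ ap≡b′q = ⊥-elim (ap≢bq {b = b′} 1≤a a<q ap≡b′q)
    ... | inj₂ refl | inj₁ bq≡a′p = ⊥-elim (ap≢bq {b = b} 1≤a′ a′<q (sym bq≡a′p))
    ... | inj₂ refl | inj₂ bq≡b′q = inj₂ (*-cancelʳ-≡ b b′ q bq≡b′q)
    from : a ≡ a′ ⊎ b ≡ b′ → ∃ λ u → Endpoint u (edge (a , b)) × Endpoint u (edge (a′ , b′))
    from (inj₁ refl) = a * p , Equivalence.from (endpoint-edge {_} {a} {b}) (inj₁ refl)
                             , Equivalence.from (endpoint-edge {_} {a} {b′}) (inj₁ refl)
    from (inj₂ refl) = b * q , Equivalence.from (endpoint-edge {_} {a} {b}) (inj₂ refl)
                             , Equivalence.from (endpoint-edge {_} {a′} {b}) (inj₂ refl)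

  lineAdj⇔rookAdj : ∀ {c₀ c} → Cell c₀ → Cell c → T (lineAdj (edge c₀) (edge c)) ⇔ RookAdj c₀ c
  lineAdj⇔rookAdj {c₀} {c} cell₀ cell = mk⇔ to from
    where
    to : T (lineAdj (edge c₀) (edge c)) → RookAdj c₀ c
    to t = let distinct , share = Equivalence.to T-∧ t in Equivalence.from rookAdj⇔
      ( (λ c₀≡c → Equivalence.to T-not⇔¬T distinct (Equivalence.from ==⇔≡ (cong edge c₀≡c)))
      , Equivalence.to (common-endpoint⇔ cell₀ cell) (Equivalence.to shareEndpoint⇔ share))
    from : RookAdj c₀ c → T (lineAdj (edge c₀) (edge c))
    from r = let c₀≢c , aligned = Equivalence.to rookAdj⇔ r in Equivalence.from T-∧
      ( Equivalence.from T-not⇔¬T (λ t → c₀≢c (edge-injective cell₀ cell (Equivalence.to ==⇔≡ t)))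
      , Equivalence.from shareEndpoint⇔ (Equivalence.from (common-endpoint⇔ cell₀ cell) aligned))

  ¬p∣∧q∣ : ∀ {z} → 0 < z → z < p * q → p ∣ z → q ∣ z → ⊥
  ¬p∣∧q∣ 0<z z<pq (divides a refl) q∣ap =
    let 1≤a , a<q = multiple-bounds {a = a} {m = p} {k = q} refl 0<z (subst (a * p <_) (*-comm p q) z<pq)
    in prime∤product q-prime 1≤a a<q q∤p q∣ap

  edge-∈ : ∀ {c} → Cell c → edge c ∈ zdEdges (p * q)
  edge-∈ {a , b} ((1≤a , a<q) , (1≤b , b<p)) = by-order (<-cmp (a * p) (b * q))
    where
    0<ap : 0 < a * p
    0<ap = *-mono-≤ 1≤a (<⇒≤ 1<p)
    0<bq : 0 < b * q
    0<bq = *-mono-≤ 1≤b (<⇒≤ (<-trans 1<p p<q))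
    ap<pq : a * p < p * q
    ap<pq = subst (a * p <_) (*-comm q p) (*-monoˡ-< p a<q)
    bq<pq : b * q < p * q
    bq<pq = *-monoˡ-< q b<p
    pq∣ap·bq : p * q ∣ (a * p) * (b * q)
    pq∣ap·bq = *-pres-∣ (n∣m*n a) (n∣m*n b)
    by-order : Tri (a * p < b * q) (a * p ≡ b * q) (b * q < a * p) → edge (a , b) ∈ zdEdges (p * q)
    by-order (tri< ap<bq _ _) = subst (_∈ zdEdges (p * q)) (sym (edge-< a b ap<bq))
      (∈-zdEdges⁺ (p * q) 0<ap ap<bq bq<pq pq∣ap·bq)
    by-order (tri≈ _ ap≡bq _) = ⊥-elim (ap≢bq {b = b} 1≤a a<q ap≡bq)
    by-order (tri> _ _ bq<ap) = subst (_∈ zdEdges (p * q)) (sym (edge-> a b bq<ap))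
      (∈-zdEdges⁺ (p * q) 0<bq bq<ap ap<pq (subst (p * q ∣_) (*-comm (a * p) (b * q)) pq∣ap·bq))

  edge-surjective : ∀ {e} → e ∈ zdEdges (p * q) → ∃ λ c → Cell c × edge c ≡ e
  edge-surjective {x , y} e∈ with ∈-zdEdges⁻ (p * q) e∈
  ... | 0<x , x<y , y<pq , pq∣xy
    with euclidsLemma x y p-prime (∣-trans (m∣m*n q) pq∣xy)
       | euclidsLemma x y q-prime (∣-trans (n∣m*n p) pq∣xy)
  ... | inj₁ p∣x | inj₁ q∣x = ⊥-elim (¬p∣∧q∣ 0<x (<-trans x<y y<pq) p∣x q∣x)
  ... | inj₂ p∣y | inj₂ q∣y = ⊥-elim (¬p∣∧q∣ (<-trans 0<x x<y) y<pq p∣y q∣y)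
  ... | inj₁ (divides a x≡ap) | inj₂ (divides b y≡bq) =
    (a , b) , ( multiple-bounds x≡ap 0<x (subst (x <_) (*-comm p q) (<-trans x<y y<pq))
              , multiple-bounds y≡bq (<-trans 0<x x<y) y<pq)
            , trans (edge-< a b (subst₂ _<_ x≡ap y≡bq x<y)) (sym (cong₂ _,_ x≡ap y≡bq))
  ... | inj₂ (divides a y≡ap) | inj₁ (divides b x≡bq) =
    (a , b) , ( multiple-bounds y≡ap (<-trans 0<x x<y) (subst (y <_) (*-comm p q) y<pq)
              , multiple-bounds x≡bq 0<x (<-trans x<y y<pq))
            , trans (edge-> a b (subst₂ _<_ x≡bq y≡ap x<y)) (sym (cong₂ _,_ x≡bq y≡ap))

  coords-cell : ∀ {e} → e ∈ zdEdges (p * q) → Cell (coords e)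
  coords-cell e∈ with c , cell , refl ← edge-surjective e∈ = subst Cell (sym (coords-edge cell)) cell

  edge-coords : ∀ {e} → e ∈ zdEdges (p * q) → edge (coords e) ≡ e
  edge-coords e∈ with c , cell , refl ← edge-surjective e∈ = cong edge (coords-edge cell)

  presentation : Presentation (LΓ (p * q))
  presentation = record
    { verts-unique  = zdEdges-unique (p * q)
    ; encode        = edge
    ; decode        = coords
    ; encode-∈      = edge-∈
    ; decode-cell   = coords-cell
    ; encode-decode = edge-coords
    ; decode-encode = coords-edge
    ; adj⇔rookAdj   = lineAdj⇔rookAdj
    }

  -- q > p ≥ 2 is odd; p may be 2.
  q-odd : odd q ≡ true
  q-odd = [ (λ q≡2 → ⊥-elim (<⇒≱ (subst (p <_) q≡2 p<q) 1<p)) , id ]′ (prime⇒2⊎odd q-prime)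

  lineGraph-vce : VeryCostEffective (LΓ (p * q))
  lineGraph-vce = rook-vce q-odd (prime⇒2⊎odd p-prime) presentation

mainTheorem4 : (p q : ℕ) → Prime p → Prime q → p < q →
               VeryCostEffective (LΓ (p * q))
mainTheorem4 p q p-prime q-prime p<q = ProductOfTwoPrimes.lineGraph-vce p-prime q-prime p<q
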